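{- Consider the polytope $P = \{ (y,x) \in \mathbb R_+^{E'} \times \mathbb R_+^V : A(y,x) = b \}$. Then the projection $P|_x = \{ x \in \mathbb R_+^V : (y,x) \in P \text{ for some } y \in \mathbb R_+^{E'} \}$ is the polytope $P_{\varrho}(G)$ of indegree vectors of orientations of $G = (V, E)$.
   Context: Let $G=(V,E)$ be a loop-free undirected multigraph, and let $P_{\varrho}(G)$ denote the indegree polytope, i.e., the convex hull in $\mathbb R^V$ of the indegree vectors of all orientations of $G$. Construct the bipartite graph $G' = (V, E; E')$, where $E'$ contains an edge between $e \in E$ and $v \in V$ if $v$ is an endpoint of $e$ in $G$. Let $A_{G'}$ denote the incidence matrix of $G'$ (rows indexed by $V \cup E$, columns by $E'$). Extend the rows of $A_{G'}$ corresponding to $V$ with a $|V| \times |V|$ negated identity matrix, and the rows corresponding to $E$ with a zero matrix (of appropriate size); let $A$ denote the resulting matrix, which is totally unimodular. Let $y \in \mathbb R_+^{E'}$ be the variables corresponding to the columns of $A_{G'}$, and $x \in \mathbb R_+^V$ the variables corresponding to the additional columns. Define $b = (0^V, 1^E)$, i.e., right-hand side $0$ for each row indexed by a vertex and $1$ for each row indexed by an edge. (Thus $A(y,x)=b$ says: for every edge $e=uv$, $y_{eu}+y_{ev}=1$, and for every vertex $v$, $x_v=\sum_{e\ni v} y_{ev}$.)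
   Formalization: The polytopes P, $P|_x$ and $P_{\varrho}(G)$ are taken over ℚ rather than ℝ: the vectors y and x and the coefficients of convex combinations are rational. -}

module Defs where

open import Data.Nat using (ℕ; zero; suc)
open import Data.Fin using (Fin; zero; suc) renaming (_≟_ to _≟ᶠ_)
open import Data.Bool using (Bool; true; false; if_then_else_)
open import Data.Product using (Σ; _×_; _,_; proj₁; proj₂; ∃)
open import Data.Sum using (_⊎_; inj₁; inj₂; [_,_])
open import Data.Rational using (ℚ; 0ℚ; 1ℚ; _+_; _*_; -_; _≤_)
open import Relation.Binary.PropositionalEquality using (_≡_; _≢_)
open import Relation.Nullary using (does)

sumFin : (k : ℕ) → (Fin k → ℚ) → ℚ
sumFin zero    f = 0ℚ
sumFin (suc k) f = f zero + sumFin k (λ i → f (suc i))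

record Multigraph (n m : ℕ) : Set where
  field
    ends     : Fin m → Fin n × Fin n
    loopFree : ∀ e → proj₁ (ends e) ≢ proj₂ (ends e)
open Multigraph public

endpoint : ∀ {n m} → Multigraph n m → Fin m → Bool → Fin n
endpoint G e false = proj₁ (ends G e)
endpoint G e true  = proj₂ (ends G e)

-- Edges of the bipartite graph G' = (V, E; E'): the pairs (e, s) meaning
-- "edge e is joined to its endpoint `endpoint G e s`" (two per edge, G loop-free).
E' : ℕ → Set
E' m = Fin m × Bool

-- Row indices V ∪ E and column indices E' ∪ V of the matrix A.
Row : ℕ → ℕ → Set
Row n m = Fin n ⊎ Fin m

Col : ℕ → ℕ → Set
Col n m = E' m ⊎ Fin n

δ : ∀ {k} → Fin k → Fin k → ℚ
δ i j = if does (i ≟ᶠ j) then 1ℚ else 0ℚ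

-- The matrix A = [ A_{G'}  -I ; A_{G'}  0 ] (incidence matrix of G' extended).
A : ∀ {n m} → Multigraph n m → Row n m → Col n m → ℚ
A G (inj₁ v) (inj₁ (e , s)) = δ (endpoint G e s) v
A G (inj₁ v) (inj₂ w)       = - δ v w
A G (inj₂ e) (inj₁ (f , s)) = δ e f
A G (inj₂ e) (inj₂ w)       = 0ℚ

mulA : ∀ {n m} → Multigraph n m → Row n m → (Col n m → ℚ) → ℚ
mulA {n} {m} G r z =
  sumFin m (λ e → A G r (inj₁ (e , false)) * z (inj₁ (e , false))
                + A G r (inj₁ (e , true))  * z (inj₁ (e , true)))
  + sumFin n (λ w → A G r (inj₂ w) * z (inj₂ w))

bvec : ∀ {n m} → Row n m → ℚ
bvec (inj₁ v) = 0ℚ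
bvec (inj₂ e) = 1ℚ

InP : ∀ {n m} → Multigraph n m → (E' m → ℚ) → (Fin n → ℚ) → Set
InP G y x =
  (∀ c → 0ℚ ≤ [ y , x ] c) × (∀ r → mulA G r [ y , x ] ≡ bvec r)

InProjection : ∀ {n m} → Multigraph n m → (Fin n → ℚ) → Set
InProjection {n} {m} G x = Σ (E' m → ℚ) λ y → InP G y x

-- An orientation chooses, for every edge, which endpoint is the head.
Orientation : ℕ → Set
Orientation m = Fin m → Bool

indegree : ∀ {n m} → Multigraph n m → Orientation m → Fin n → ℚ
indegree {n} {m} G o v = sumFin m (λ e → δ (endpoint G e (o e)) v)

InConvexHull : ∀ {n} → ((Fin n → ℚ) → Set) → (Fin n → ℚ) → Set
InConvexHull {n} S x =
  Σ ℕ λ k → Σ (Fin k → (Fin n → ℚ)) λ p → Σ (Fin k → ℚ) λ λs →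
    (∀ i → S (p i)) × (∀ i → 0ℚ ≤ λs i) × (sumFin k λs ≡ 1ℚ)
    × (∀ v → x v ≡ sumFin k (λ i → λs i * p i v))

IsIndegreeVector : ∀ {n m} → Multigraph n m → (Fin n → ℚ) → Set
IsIndegreeVector {n} {m} G d = Σ (Orientation m) λ o → ∀ v → d v ≡ indegree G o v

InIndegreePolytope : ∀ {n m} → Multigraph n m → (Fin n → ℚ) → Set
InIndegreePolytope G = InConvexHull (IsIndegreeVector G)

{-# OPTIONS --safe #-}
module Submission where

-- Each edge row of A(y,x) = b says that y splits one unit between the two
-- endpoints of the edge (a fractional orientation), and each vertex row says
-- that x is the resulting fractional indegree vector, which is linear in y.
-- Orientations are the 0/1 fractional orientations, so convex combinations of
-- indegree vectors are fractional indegree vectors. Conversely, a fractional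
-- indegree vector is a sum over the edges of points on the segments joining
-- the unit vectors of their endpoints; by induction on the number of edges
-- such a sum lies in the convex hull of the sums of segment endpoints, i.e. of
-- the indegree vectors.

open import Defs
open import Data.Nat using (ℕ; zero; suc) renaming (_+_ to _+ℕ_)
open import Data.Fin using (Fin; zero; suc; splitAt) renaming (_≟_ to _≟ᶠ_)
open import Relation.Nullary using (yes; no)
open import Data.Bool using (Bool; true; false)
open import Data.Product using (Σ; _×_; _,_; proj₁; proj₂)
open import Data.Sum using (inj₁; inj₂; [_,_])
open import Data.Sum.Properties using ([,]-map)
open import Data.Vec.Functional using (_++_; zipWith)
open import Data.Rational using (ℚ; 0ℚ; 1ℚ; _+_; _*_; -_; _-_; _≤_; nonNegative)
open import Data.Rational.Properties
open import Data.Rational.Solver using (module +-*-Solver)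
open import Algebra.Bundles using (CommutativeRing)
open import Algebra.Properties.Semiring.Sum (CommutativeRing.semiring +-*-commutativeRing)
  using (sum; ∑-distrib-+; ∑-comm; *-distribˡ-sum; sum-replicate-zero)
open import Algebra.Properties.Group +-0-group using (x∙y⁻¹≈ε⇒x≈y)
open import Function using (_∘_)
open import Function.Bundles using (_⇔_; mk⇔; Equivalence)
open import Function.Construct.Composition using (_⇔-∘_)
open import Relation.Binary.PropositionalEquality hiding ([_])

open ≡-Reasoning

+-pres-nonNeg : ∀ {p q} → 0ℚ ≤ p → 0ℚ ≤ q → 0ℚ ≤ p + q
+-pres-nonNeg {p} {q} 0≤p 0≤q =
  nonNegative⁻¹ _ {{nonNeg+nonNeg⇒nonNeg p {{nonNegative 0≤p}} q {{nonNegative 0≤q}}}}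

*-pres-nonNeg : ∀ {p q} → 0ℚ ≤ p → 0ℚ ≤ q → 0ℚ ≤ p * q
*-pres-nonNeg {p} {q} 0≤p 0≤q =
  nonNegative⁻¹ _ {{nonNeg*nonNeg⇒nonNeg p {{nonNegative 0≤p}} q {{nonNegative 0≤q}}}}

0≤1 : 0ℚ ≤ 1ℚ
0≤1 = nonNegative⁻¹ 1ℚ

0≤δ : ∀ {k} (i j : Fin k) → 0ℚ ≤ δ i j
0≤δ i j with i ≟ᶠ j
... | yes _ = 0≤1
... | no _  = ≤-refl

sumFin≡sum : ∀ k (f : Fin k → ℚ) → sumFin k f ≡ sum f
sumFin≡sum zero    f = refl
sumFin≡sum (suc k) f = cong (f zero +_) (sumFin≡sum k (f ∘ suc))

sumFin-cong : ∀ k {f g : Fin k → ℚ} → f ≗ g → sumFin k f ≡ sumFin k g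
sumFin-cong zero    f≗g = refl
sumFin-cong (suc k) f≗g = cong₂ _+_ (f≗g zero) (sumFin-cong k (f≗g ∘ suc))

sumFin-zero : ∀ k → sumFin k (λ _ → 0ℚ) ≡ 0ℚ
sumFin-zero k = trans (sumFin≡sum k _) (sum-replicate-zero k)

sumFin-+ : ∀ k (f g : Fin k → ℚ) → sumFin k (λ i → f i + g i) ≡ sumFin k f + sumFin k g
sumFin-+ k f g = begin
  sumFin k (λ i → f i + g i)  ≡⟨ sumFin≡sum k _ ⟩
  sum (λ i → f i + g i)       ≡⟨ ∑-distrib-+ f g ⟩
  sum f + sum g               ≡⟨ cong₂ _+_ (sumFin≡sum k f) (sumFin≡sum k g) ⟨
  sumFin k f + sumFin k g     ∎

*-distribˡ-sumFin : ∀ k c (f : Fin k → ℚ) → c * sumFin k f ≡ sumFin k (λ i → c * f i)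
*-distribˡ-sumFin k c f = begin
  c * sumFin k f             ≡⟨ cong (c *_) (sumFin≡sum k f) ⟩
  c * sum f                  ≡⟨ *-distribˡ-sum c f ⟩
  sum (λ i → c * f i)        ≡⟨ sumFin≡sum k _ ⟨
  sumFin k (λ i → c * f i)   ∎

sumFin-comm : ∀ k l (f : Fin k → Fin l → ℚ) →
  sumFin k (λ i → sumFin l (f i)) ≡ sumFin l (λ j → sumFin k (λ i → f i j))
sumFin-comm k l f = begin
  sumFin k (λ i → sumFin l (f i))          ≡⟨ sumFin-cong k (λ i → sumFin≡sum l (f i)) ⟩
  sumFin k (λ i → sum (f i))               ≡⟨ sumFin≡sum k _ ⟩
  sum (λ i → sum (f i))                    ≡⟨ ∑-comm f ⟩
  sum (λ j → sum (λ i → f i j))            ≡⟨ sumFin≡sum l _ ⟨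
  sumFin l (λ j → sum (λ i → f i j))       ≡⟨ sumFin-cong l (λ j → sumFin≡sum k (λ i → f i j)) ⟨
  sumFin l (λ j → sumFin k (λ i → f i j))  ∎

sumFin-δ : ∀ k (i : Fin k) (g : Fin k → ℚ) → sumFin k (λ j → δ i j * g j) ≡ g i
sumFin-δ (suc k) zero g = begin
  1ℚ * g zero + sumFin k (λ j → 0ℚ * g (suc j))  ≡⟨ cong₂ _+_ (*-identityˡ (g zero))
                                                      (sumFin-cong k (λ j → *-zeroˡ (g (suc j)))) ⟩
  g zero + sumFin k (λ _ → 0ℚ)                   ≡⟨ cong (g zero +_) (sumFin-zero k) ⟩
  g zero + 0ℚ                                    ≡⟨ +-identityʳ (g zero) ⟩
  g zero                                         ∎
sumFin-δ (suc k) (suc i) g =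
  trans (cong₂ _+_ (*-zeroˡ (g zero)) (sumFin-δ k i (g ∘ suc))) (+-identityˡ (g (suc i)))

sumFin-nonNeg : ∀ k {f : Fin k → ℚ} → (∀ i → 0ℚ ≤ f i) → 0ℚ ≤ sumFin k f
sumFin-nonNeg zero    0≤f = ≤-refl
sumFin-nonNeg (suc k) 0≤f = +-pres-nonNeg (0≤f zero) (sumFin-nonNeg k (0≤f ∘ suc))

sumFin-++ : ∀ k l (f : Fin k → ℚ) (g : Fin l → ℚ) → sumFin (k +ℕ l) (f ++ g) ≡ sumFin k f + sumFin l g
sumFin-++ zero    l f g = sym (+-identityˡ (sumFin l g))
sumFin-++ (suc k) l f g = begin
  f zero + sumFin (k +ℕ l) (λ i → (f ++ g) (suc i))  ≡⟨ cong (f zero +_) (sumFin-cong (k +ℕ l) (λ i → [,]-map (splitAt k i))) ⟩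
  f zero + sumFin (k +ℕ l) ((f ∘ suc) ++ g)          ≡⟨ cong (f zero +_) (sumFin-++ k l (f ∘ suc) g) ⟩
  f zero + (sumFin k (f ∘ suc) + sumFin l g)         ≡⟨ +-assoc (f zero) _ _ ⟨
  sumFin (suc k) f + sumFin l g                      ∎

++⁺ : ∀ {A : Set} (P : A → Set) {k l} {xs : Fin k → A} {ys : Fin l → A} →
  (∀ i → P (xs i)) → (∀ j → P (ys j)) → ∀ i → P ((xs ++ ys) i)
++⁺ P {k} Pxs Pys i with splitAt k i
... | inj₁ j = Pxs j
... | inj₂ j = Pys j

zipWith-++ : ∀ {A B C : Set} (f : A → B → C) {k l} (xs : Fin k → A) (ys : Fin l → A)
  (xs′ : Fin k → B) (ys′ : Fin l → B) →
  zipWith f (xs ++ ys) (xs′ ++ ys′) ≗ zipWith f xs xs′ ++ zipWith f ys ys′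
zipWith-++ f {k} xs ys xs′ ys′ i with splitAt k i
... | inj₁ j = refl
... | inj₂ j = refl

module _ {n : ℕ} {S : (Fin n → ℚ) → Set} where

  InConvexHull-resp-≗ : ∀ {x y} → x ≗ y → InConvexHull S x → InConvexHull S y
  InConvexHull-resp-≗ x≗y (k , p , l , p∈S , 0≤l , ∑l≡1 , x≡) =
    k , p , l , p∈S , 0≤l , ∑l≡1 , λ v → trans (sym (x≗y v)) (x≡ v)

  InConvexHull-member : ∀ {x} → S x → InConvexHull S x
  InConvexHull-member {x} x∈S =
    1 , (λ _ → x) , (λ _ → 1ℚ) , (λ _ → x∈S) , (λ _ → 0≤1) , +-identityʳ 1ℚ ,
    λ v → sym (trans (+-identityʳ (1ℚ * x v)) (*-identityˡ (x v)))

  InConvexHull-translate : ∀ {T : (Fin n → ℚ) → Set} {x} (q : Fin n → ℚ) →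
    (∀ {d} → S d → T (λ v → q v + d v)) → InConvexHull S x → InConvexHull T (λ v → q v + x v)
  InConvexHull-translate {x = x} q q+S⊆T (k , p , l , p∈S , 0≤l , ∑l≡1 , x≡) =
    k , (λ i v → q v + p i v) , l , q+S⊆T ∘ p∈S , 0≤l , ∑l≡1 , λ v → begin
      q v + x v                                                    ≡⟨ cong₂ _+_ (sym (*-identityʳ (q v))) (x≡ v) ⟩
      q v * 1ℚ + sumFin k (λ i → l i * p i v)                      ≡⟨ cong (λ t → q v * t + sumFin k (λ i → l i * p i v)) ∑l≡1 ⟨
      q v * sumFin k l + sumFin k (λ i → l i * p i v)              ≡⟨ cong (_+ _) (*-distribˡ-sumFin k (q v) l) ⟩
      sumFin k (λ i → q v * l i) + sumFin k (λ i → l i * p i v)    ≡⟨ sumFin-+ k _ _ ⟨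
      sumFin k (λ i → q v * l i + l i * p i v)                     ≡⟨ sumFin-cong k (λ i → factor (q v) (l i) (p i v)) ⟩
      sumFin k (λ i → l i * (q v + p i v))                         ∎
    where
    factor : ∀ c w d → c * w + w * d ≡ w * (c + d)
    factor c w d = trans (cong (_+ w * d) (*-comm c w)) (sym (*-distribˡ-+ w c d))

  InConvexHull-convex : ∀ {x y α β} → 0ℚ ≤ α → 0ℚ ≤ β → α + β ≡ 1ℚ →
    InConvexHull S x → InConvexHull S y → InConvexHull S (λ v → α * x v + β * y v)
  InConvexHull-convex {x} {y} {α} {β} 0≤α 0≤β α+β≡1
    (k , p , l , p∈S , 0≤l , ∑l≡1 , x≡) (k′ , p′ , l′ , p′∈S , 0≤l′ , ∑l′≡1 , y≡) =
    k +ℕ k′ , p ++ p′ , μ ++ μ′ , ++⁺ S p∈S p′∈S ,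
    ++⁺ (0ℚ ≤_) (*-pres-nonNeg 0≤α ∘ 0≤l) (*-pres-nonNeg 0≤β ∘ 0≤l′) , ∑μ≡1 , z≡
    where
    μ : Fin k → ℚ
    μ i = α * l i
    μ′ : Fin k′ → ℚ
    μ′ i = β * l′ i
    scale : ∀ {j} γ (w f : Fin j → ℚ) → γ * sumFin j (λ i → w i * f i) ≡ sumFin j (λ i → γ * w i * f i)
    scale {j} γ w f = trans (*-distribˡ-sumFin j γ _) (sumFin-cong j (λ i → sym (*-assoc γ (w i) (f i))))
    ∑μ≡1 : sumFin (k +ℕ k′) (μ ++ μ′) ≡ 1ℚ
    ∑μ≡1 = begin
      sumFin (k +ℕ k′) (μ ++ μ′)         ≡⟨ sumFin-++ k k′ μ μ′ ⟩
      sumFin k μ + sumFin k′ μ′          ≡⟨ cong₂ _+_ (*-distribˡ-sumFin k α l) (*-distribˡ-sumFin k′ β l′) ⟨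
      α * sumFin k l + β * sumFin k′ l′  ≡⟨ cong₂ (λ s t → α * s + β * t) ∑l≡1 ∑l′≡1 ⟩
      α * 1ℚ + β * 1ℚ                    ≡⟨ cong₂ _+_ (*-identityʳ α) (*-identityʳ β) ⟩
      α + β                              ≡⟨ α+β≡1 ⟩
      1ℚ                                 ∎
    z≡ : ∀ v → α * x v + β * y v ≡ sumFin (k +ℕ k′) (λ i → (μ ++ μ′) i * (p ++ p′) i v)
    z≡ v = begin
      α * x v + β * y v
        ≡⟨ cong₂ (λ s t → α * s + β * t) (x≡ v) (y≡ v) ⟩
      α * sumFin k (λ i → l i * p i v) + β * sumFin k′ (λ i → l′ i * p′ i v)
        ≡⟨ cong₂ _+_ (scale α l (λ i → p i v)) (scale β l′ (λ i → p′ i v)) ⟩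
      sumFin k (λ i → μ i * p i v) + sumFin k′ (λ i → μ′ i * p′ i v)
        ≡⟨ sumFin-++ k k′ _ _ ⟨
      sumFin (k +ℕ k′) ((λ i → μ i * p i v) ++ (λ i → μ′ i * p′ i v))
        ≡⟨ sumFin-cong (k +ℕ k′) (zipWith-++ (λ w q → w * q v) μ μ′ p p′) ⟨
      sumFin (k +ℕ k′) (λ i → (μ ++ μ′) i * (p ++ p′) i v)
        ∎

FractionalOrientation : ∀ {m} → (E' m → ℚ) → Set
FractionalOrientation y = (∀ c → 0ℚ ≤ y c) × (∀ e → y (e , false) + y (e , true) ≡ 1ℚ)

convex-+ʳ : ∀ {α β} (a b r : ℚ) → α + β ≡ 1ℚ → α * (a + r) + β * (b + r) ≡ (a * α + b * β) + r
convex-+ʳ {α} {β} a b r α+β≡1 = begin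
  α * (a + r) + β * (b + r)          ≡⟨ solve 5 (λ α β a b r → α :* (a :+ r) :+ β :* (b :+ r)
                                          := (a :* α :+ b :* β) :+ (α :+ β) :* r) refl α β a b r ⟩
  (a * α + b * β) + (α + β) * r      ≡⟨ cong (λ t → (a * α + b * β) + t * r) α+β≡1 ⟩
  (a * α + b * β) + 1ℚ * r           ≡⟨ cong ((a * α + b * β) +_) (*-identityˡ r) ⟩
  (a * α + b * β) + r                ∎
  where open +-*-Solver

module _ {n : ℕ} where

  SelectionSum : ∀ {k} → (Fin k → Bool → Fin n → ℚ) → (Fin n → ℚ) → Set
  SelectionSum {k} a d = Σ (Fin k → Bool) λ o → ∀ v → d v ≡ sumFin k (λ e → a e (o e) v)

  SelectionSum-cons : ∀ {k} (a : Fin (suc k) → Bool → Fin n → ℚ) s {d} →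
    SelectionSum (a ∘ suc) d → SelectionSum a (λ v → a zero s v + d v)
  SelectionSum-cons a s (o , d≡) = (λ { zero → s ; (suc e) → o e }) , λ v → cong (a zero s v +_) (d≡ v)

  fractionalSum : ∀ {k} → (Fin k → Bool → Fin n → ℚ) → (E' k → ℚ) → Fin n → ℚ
  fractionalSum {k} a y v = sumFin k (λ e → a e false v * y (e , false) + a e true v * y (e , true))

  fractionalSum-nonNeg : ∀ {k} {a : Fin k → Bool → Fin n → ℚ} {y : E' k → ℚ} →
    (∀ e s v → 0ℚ ≤ a e s v) → (∀ c → 0ℚ ≤ y c) → ∀ v → 0ℚ ≤ fractionalSum a y v
  fractionalSum-nonNeg {k} 0≤a 0≤y v = sumFin-nonNeg k λ e →
    +-pres-nonNeg (*-pres-nonNeg (0≤a e false v) (0≤y (e , false)))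
                  (*-pres-nonNeg (0≤a e true v) (0≤y (e , true)))

  fractionalSum∈InConvexHull : ∀ {k} (a : Fin k → Bool → Fin n → ℚ) {y : E' k → ℚ} →
    FractionalOrientation y → InConvexHull (SelectionSum a) (fractionalSum a y)
  fractionalSum∈InConvexHull {zero}  a _ = InConvexHull-member {S = SelectionSum a} ((λ ()) , λ v → refl)
  -- The point is the y-weighted mix, over the two choices for edge zero, of
  -- that choice's endpoint plus the fractional sum of the remaining edges.
  fractionalSum∈InConvexHull {suc k} a {y} (0≤y , y-sum) =
    InConvexHull-resp-≗ {S = SelectionSum a} split
      (InConvexHull-convex {S = SelectionSum a} (0≤y (zero , false)) (0≤y (zero , true)) (y-sum zero)
        (headAt false) (headAt true))
    where
    y′ : E' k → ℚ
    y′ (e , s) = y (suc e , s)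
    rest : Fin n → ℚ
    rest = fractionalSum (a ∘ suc) y′
    headAt : ∀ s → InConvexHull (SelectionSum a) (λ v → a zero s v + rest v)
    headAt s = InConvexHull-translate {T = SelectionSum a} (a zero s) (SelectionSum-cons a s)
      (fractionalSum∈InConvexHull (a ∘ suc) ((λ (e , s) → 0≤y (suc e , s)) , y-sum ∘ suc))
    split : (λ v → y (zero , false) * (a zero false v + rest v) + y (zero , true) * (a zero true v + rest v))
            ≗ fractionalSum a y
    split v = convex-+ʳ (a zero false v) (a zero true v) (rest v) (y-sum zero)

δᵇ : Bool → Bool → ℚ
δᵇ false false = 1ℚ
δᵇ false true  = 0ℚ
δᵇ true  false = 0ℚ
δᵇ true  true  = 1ℚ

indicator : ∀ {k} → (Fin k → Bool) → E' k → ℚ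
indicator o (e , s) = δᵇ (o e) s

indicator-fractional : ∀ {k} (o : Fin k → Bool) → FractionalOrientation (indicator o)
indicator-fractional o = (λ (e , s) → 0≤δᵇ (o e) s) , λ e → δᵇ-sum (o e)
  where
  0≤δᵇ : ∀ b s → 0ℚ ≤ δᵇ b s
  0≤δᵇ false false = 0≤1
  0≤δᵇ false true  = ≤-refl
  0≤δᵇ true  false = ≤-refl
  0≤δᵇ true  true  = 0≤1
  δᵇ-sum : ∀ b → δᵇ b false + δᵇ b true ≡ 1ℚ
  δᵇ-sum false = +-identityʳ 1ℚ
  δᵇ-sum true  = +-identityˡ 1ℚ

fractionalSum-indicator : ∀ {n k} (a : Fin k → Bool → Fin n → ℚ) (o : Fin k → Bool) →
  fractionalSum a (indicator o) ≗ λ v → sumFin k (λ e → a e (o e) v)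
fractionalSum-indicator {k = k} a o v = sumFin-cong k λ e → select (λ s → a e s v) (o e)
  where
  select : ∀ (f : Bool → ℚ) b → f false * δᵇ b false + f true * δᵇ b true ≡ f b
  select f false = trans (cong₂ _+_ (*-identityʳ (f false)) (*-zeroʳ (f true))) (+-identityʳ (f false))
  select f true  = trans (cong₂ _+_ (*-zeroʳ (f false)) (*-identityʳ (f true))) (+-identityˡ (f true))

combination : ∀ {j} {A : Set} → (Fin j → ℚ) → (Fin j → A → ℚ) → A → ℚ
combination {j} l ys c = sumFin j (λ i → l i * ys i c)

sumFin-linear₂ : ∀ j (l u w : Fin j → ℚ) p q →
  p * sumFin j (λ i → l i * u i) + q * sumFin j (λ i → l i * w i) ≡ sumFin j (λ i → l i * (p * u i + q * w i))
sumFin-linear₂ j l u w p q = begin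
  p * sumFin j (λ i → l i * u i) + q * sumFin j (λ i → l i * w i)
    ≡⟨ cong₂ _+_ (*-distribˡ-sumFin j p _) (*-distribˡ-sumFin j q _) ⟩
  sumFin j (λ i → p * (l i * u i)) + sumFin j (λ i → q * (l i * w i))
    ≡⟨ sumFin-+ j _ _ ⟨
  sumFin j (λ i → p * (l i * u i) + q * (l i * w i))
    ≡⟨ sumFin-cong j (λ i → solve 5 (λ l u w p q → p :* (l :* u) :+ q :* (l :* w) := l :* (p :* u :+ q :* w))
                                   refl (l i) (u i) (w i) p q) ⟩
  sumFin j (λ i → l i * (p * u i + q * w i))
    ∎
  where open +-*-Solver

fractionalSum-combination : ∀ {n k j} (a : Fin k → Bool → Fin n → ℚ) (l : Fin j → ℚ) (ys : Fin j → E' k → ℚ) →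
  fractionalSum a (combination l ys) ≗ combination l (λ i → fractionalSum a (ys i))
fractionalSum-combination {k = k} {j} a l ys v = begin
  fractionalSum a (combination l ys) v
    ≡⟨ sumFin-cong k (λ e → sumFin-linear₂ j l _ _ (a e false v) (a e true v)) ⟩
  sumFin k (λ e → sumFin j (λ i → l i * term i e))
    ≡⟨ sumFin-comm k j _ ⟩
  sumFin j (λ i → sumFin k (λ e → l i * term i e))
    ≡⟨ sumFin-cong j (λ i → *-distribˡ-sumFin k (l i) (term i)) ⟨
  combination l (λ i → fractionalSum a (ys i)) v
    ∎
  where
  term : Fin j → Fin k → ℚ
  term i e = a e false v * ys i (e , false) + a e true v * ys i (e , true)

combination-fractional : ∀ {k j} {l : Fin j → ℚ} {ys : Fin j → E' k → ℚ} →
  (∀ i → 0ℚ ≤ l i) → sumFin j l ≡ 1ℚ → (∀ i → FractionalOrientation (ys i)) →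
  FractionalOrientation (combination l ys)
combination-fractional {j = j} {l} {ys} 0≤l ∑l≡1 ys-fractional =
  (λ c → sumFin-nonNeg j (λ i → *-pres-nonNeg (0≤l i) (proj₁ (ys-fractional i) c))) , edgeSum
  where
  edgeSum : ∀ e → combination l ys (e , false) + combination l ys (e , true) ≡ 1ℚ
  edgeSum e = begin
    combination l ys (e , false) + combination l ys (e , true)
      ≡⟨ sumFin-+ j _ _ ⟨
    sumFin j (λ i → l i * ys i (e , false) + l i * ys i (e , true))
      ≡⟨ sumFin-cong j (λ i → sym (*-distribˡ-+ (l i) _ _)) ⟩
    sumFin j (λ i → l i * (ys i (e , false) + ys i (e , true)))
      ≡⟨ sumFin-cong j (λ i → trans (cong (l i *_) (proj₂ (ys-fractional i) e)) (*-identityʳ (l i))) ⟩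
    sumFin j l
      ≡⟨ ∑l≡1 ⟩
    1ℚ
      ∎

module _ {n m : ℕ} (G : Multigraph n m) where

  endpointUnit : Fin m → Bool → Fin n → ℚ
  endpointUnit e s = δ (endpoint G e s)

  fractionalIndegree : (E' m → ℚ) → Fin n → ℚ
  fractionalIndegree = fractionalSum endpointUnit

  IsFractionalIndegreeVector : (Fin n → ℚ) → Set
  IsFractionalIndegreeVector x = Σ (E' m → ℚ) λ y → FractionalOrientation y × x ≗ fractionalIndegree y

  edgeRow : ∀ y x e → mulA G (inj₂ e) [ y , x ] ≡ y (e , false) + y (e , true)
  edgeRow y x e = begin
    sumFin m (λ f → δ e f * y (f , false) + δ e f * y (f , true)) + sumFin n (λ w → 0ℚ * x w)
      ≡⟨ cong₂ _+_ (sumFin-cong m (λ f → sym (*-distribˡ-+ (δ e f) _ _))) (sumFin-cong n (*-zeroˡ ∘ x)) ⟩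
    sumFin m (λ f → δ e f * (y (f , false) + y (f , true))) + sumFin n (λ _ → 0ℚ)
      ≡⟨ cong₂ _+_ (sumFin-δ m e _) (sumFin-zero n) ⟩
    y (e , false) + y (e , true) + 0ℚ
      ≡⟨ +-identityʳ _ ⟩
    y (e , false) + y (e , true)
      ∎

  vertexRow : ∀ y x v → mulA G (inj₁ v) [ y , x ] ≡ fractionalIndegree y v - x v
  vertexRow y x v = cong (fractionalIndegree y v +_) (begin
    sumFin n (λ w → - δ v w * x w)  ≡⟨ sumFin-cong n (λ w → trans (sym (neg-distribˡ-* (δ v w) (x w)))
                                                                  (neg-distribʳ-* (δ v w) (x w))) ⟩
    sumFin n (λ w → δ v w * - x w)  ≡⟨ sumFin-δ n v (-_ ∘ x) ⟩
    - x v                           ∎)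

  InP⇔fractional : ∀ {y x} → InP G y x ⇔ (FractionalOrientation y × x ≗ fractionalIndegree y)
  InP⇔fractional {y} {x} = mk⇔
    (λ (0≤yx , rows) →
      (0≤yx ∘ inj₁ , λ e → trans (sym (edgeRow y x e)) (rows (inj₂ e))) ,
      λ v → sym (x∙y⁻¹≈ε⇒x≈y _ _ (trans (sym (vertexRow y x v)) (rows (inj₁ v)))))
    (λ ((0≤y , y-sum) , x≗) →
      (λ { (inj₁ c) → 0≤y c
         ; (inj₂ v) → subst (0ℚ ≤_) (sym (x≗ v)) (fractionalSum-nonNeg (λ e s → 0≤δ (endpoint G e s)) 0≤y v) }) ,
      λ { (inj₁ v) → trans (vertexRow y x v) (trans (cong (_- x v) (sym (x≗ v))) (+-inverseʳ (x v)))
        ; (inj₂ e) → trans (edgeRow y x e) (y-sum e) })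

  InProjection⇔fractional : ∀ {x} → InProjection G x ⇔ IsFractionalIndegreeVector x
  InProjection⇔fractional = mk⇔ (λ (y , inP) → y , Equivalence.to InP⇔fractional inP)
                                (λ (y , fr) → y , Equivalence.from InP⇔fractional fr)

  fractional⇒InIndegreePolytope : ∀ {x} → IsFractionalIndegreeVector x → InIndegreePolytope G x
  fractional⇒InIndegreePolytope (y , y-fractional , x≗) =
    -- IsIndegreeVector G unfolds to SelectionSum endpointUnit.
    InConvexHull-resp-≗ {S = IsIndegreeVector G} (sym ∘ x≗) (fractionalSum∈InConvexHull endpointUnit y-fractional)

  InIndegreePolytope⇒fractional : ∀ {x} → InIndegreePolytope G x → IsFractionalIndegreeVector x
  InIndegreePolytope⇒fractional {x} (k , p , l , p-indegree , 0≤l , ∑l≡1 , x≡) =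
    combination l (indicator ∘ o) ,
    combination-fractional 0≤l ∑l≡1 (indicator-fractional ∘ o) ,
    λ v → begin
      x v
        ≡⟨ x≡ v ⟩
      combination l p v
        ≡⟨ sumFin-cong k (λ i → cong (l i *_) (proj₂ (p-indegree i) v)) ⟩
      combination l (λ i → indegree G (o i)) v
        ≡⟨ sumFin-cong k (λ i → cong (l i *_) (fractionalSum-indicator endpointUnit (o i) v)) ⟨
      combination l (λ i → fractionalIndegree (indicator (o i))) v
        ≡⟨ fractionalSum-combination endpointUnit l (indicator ∘ o) v ⟨
      fractionalIndegree (combination l (indicator ∘ o)) v
        ∎
    where
    o : Fin k → Orientation m
    o i = proj₁ (p-indegree i)

theorem2 : (n m : ℕ) (G : Multigraph n m) (x : Fin n → ℚ) →
    InProjection G x ⇔ InIndegreePolytope G x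
theorem2 n m G x =
  mk⇔ (fractional⇒InIndegreePolytope G) (InIndegreePolytope⇒fractional G) ⇔-∘ InProjection⇔fractional G
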